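{- A graph $G$ is $2K_2$-split if and only if $G$ has no induced subgraph isomorphic to any of the following graphs: $C_4$, $C_5$, $K_2+P_3$, $K_2+K_3$, $P_5$, the co-banner, and $3K_2$.
   Context: All graphs are finite and simple; $G+H$ is disjoint union and $nG$ the disjoint union of $n$ copies of $G$. A graph $G$ is $2K_2$-split if $V_G$ has a partition $(C,S,I)$ such that $C$ is a clique, $I$ is an independent set, either $S=\varnothing$ or $G[S]\cong 2K_2$, every vertex of $C$ is adjacent to every vertex of $S$, and there are no edges between $I$ and $S$. The co-banner is the graph on vertices $a,b,c,d,e$ with edges $ab,bc,ad,ae,de$ (a triangle $ade$ with a path $a$–$b$–$c$ attached at $a$), i.e. the complement of the banner ($C_4$ with a pendant vertex). -}

module Defs where

open import Data.Nat using (ℕ; _≡ᵇ_)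
open import Data.Fin using (Fin; zero; suc; toℕ)
open import Data.Bool using (Bool; true; false; _∨_; _∧_)
open import Data.Bool.Properties using (∨-comm)
open import Data.List using (List; []; _∷_)
open import Data.Bool.ListAction using (any)
open import Data.Product using (Σ; ∃; _×_; _,_)
open import Data.Sum using (_⊎_)
open import Relation.Binary.PropositionalEquality using (_≡_; _≢_; refl)
open import Relation.Nullary using (¬_)
open import Function.Definitions using (Injective)

record Graph : Set where
  field
    n      : ℕ
    adj    : Fin n → Fin n → Bool
    sym    : ∀ i j → adj i j ≡ adj j i
    irrefl : ∀ i → adj i i ≡ false
open Graph public

record InducedSub (H G : Graph) : Set where
  field
    emb      : Fin (n H) → Fin (n G)
    emb-inj  : Injective _≡_ _≡_ emb
    emb-adj  : ∀ i j → adj H i j ≡ adj G (emb i) (emb j)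

Free : Graph → Graph → Set
Free H G = ¬ InducedSub H G

hasEdge : List (ℕ × ℕ) → ℕ → ℕ → Bool
hasEdge es a b = any (λ { (x , y) → (x ≡ᵇ a) ∧ (y ≡ᵇ b) }) es

edgeAdj : ∀ {k} → List (ℕ × ℕ) → Fin k → Fin k → Bool
edgeAdj es i j = hasEdge es (toℕ i) (toℕ j) ∨ hasEdge es (toℕ j) (toℕ i)

edgeAdj-sym : ∀ {k} (es : List (ℕ × ℕ)) (i j : Fin k) → edgeAdj es i j ≡ edgeAdj es j i
edgeAdj-sym es i j = ∨-comm (hasEdge es (toℕ i) (toℕ j)) (hasEdge es (toℕ j) (toℕ i))

C4 : Graph
C4 = record { n = 4 ; adj = edgeAdj es ; sym = edgeAdj-sym es ; irrefl = ir }
  where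
  es = (0 , 1) ∷ (1 , 2) ∷ (2 , 3) ∷ (3 , 0) ∷ []
  ir : ∀ i → edgeAdj es i i ≡ false
  ir zero = refl
  ir (suc zero) = refl
  ir (suc (suc zero)) = refl
  ir (suc (suc (suc zero))) = refl

C5 : Graph
C5 = record { n = 5 ; adj = edgeAdj es ; sym = edgeAdj-sym es ; irrefl = ir }
  where
  es = (0 , 1) ∷ (1 , 2) ∷ (2 , 3) ∷ (3 , 4) ∷ (4 , 0) ∷ []
  ir : ∀ i → edgeAdj es i i ≡ false
  ir zero = refl
  ir (suc zero) = refl
  ir (suc (suc zero)) = refl
  ir (suc (suc (suc zero))) = refl
  ir (suc (suc (suc (suc zero)))) = refl

K2+P3 : Graph
K2+P3 = record { n = 5 ; adj = edgeAdj es ; sym = edgeAdj-sym es ; irrefl = ir }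
  where
  es = (0 , 1) ∷ (2 , 3) ∷ (3 , 4) ∷ []
  ir : ∀ i → edgeAdj es i i ≡ false
  ir zero = refl
  ir (suc zero) = refl
  ir (suc (suc zero)) = refl
  ir (suc (suc (suc zero))) = refl
  ir (suc (suc (suc (suc zero)))) = refl

K2+K3 : Graph
K2+K3 = record { n = 5 ; adj = edgeAdj es ; sym = edgeAdj-sym es ; irrefl = ir }
  where
  es = (0 , 1) ∷ (2 , 3) ∷ (3 , 4) ∷ (2 , 4) ∷ []
  ir : ∀ i → edgeAdj es i i ≡ false
  ir zero = refl
  ir (suc zero) = refl
  ir (suc (suc zero)) = refl
  ir (suc (suc (suc zero))) = refl
  ir (suc (suc (suc (suc zero)))) = refl

P5 : Graph
P5 = record { n = 5 ; adj = edgeAdj es ; sym = edgeAdj-sym es ; irrefl = ir }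
  where
  es = (0 , 1) ∷ (1 , 2) ∷ (2 , 3) ∷ (3 , 4) ∷ []
  ir : ∀ i → edgeAdj es i i ≡ false
  ir zero = refl
  ir (suc zero) = refl
  ir (suc (suc zero)) = refl
  ir (suc (suc (suc zero))) = refl
  ir (suc (suc (suc (suc zero)))) = refl

coBanner : Graph
coBanner = record { n = 5 ; adj = edgeAdj es ; sym = edgeAdj-sym es ; irrefl = ir }
  where
  es = (0 , 1) ∷ (1 , 2) ∷ (0 , 3) ∷ (0 , 4) ∷ (3 , 4) ∷ []
  ir : ∀ i → edgeAdj es i i ≡ false
  ir zero = refl
  ir (suc zero) = refl
  ir (suc (suc zero)) = refl
  ir (suc (suc (suc zero))) = refl
  ir (suc (suc (suc (suc zero)))) = refl

2K2 : Graph
2K2 = record { n = 4 ; adj = edgeAdj es ; sym = edgeAdj-sym es ; irrefl = ir }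
  where
  es = (0 , 1) ∷ (2 , 3) ∷ []
  ir : ∀ i → edgeAdj es i i ≡ false
  ir zero = refl
  ir (suc zero) = refl
  ir (suc (suc zero)) = refl
  ir (suc (suc (suc zero))) = refl

3K2 : Graph
3K2 = record { n = 6 ; adj = edgeAdj es ; sym = edgeAdj-sym es ; irrefl = ir }
  where
  es = (0 , 1) ∷ (2 , 3) ∷ (4 , 5) ∷ []
  ir : ∀ i → edgeAdj es i i ≡ false
  ir zero = refl
  ir (suc zero) = refl
  ir (suc (suc zero)) = refl
  ir (suc (suc (suc zero))) = refl
  ir (suc (suc (suc (suc zero)))) = refl
  ir (suc (suc (suc (suc (suc zero))))) = refl

data Part : Set where
  inC inS inI : Part

Induces2K2 : (G : Graph) → (Fin (n G) → Part) → Set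
Induces2K2 G p =
  Σ (Fin 4 → Fin (n G)) λ f →
    Injective _≡_ _≡_ f
    × (∀ i → p (f i) ≡ inS)
    × (∀ v → p v ≡ inS → ∃ λ i → f i ≡ v)
    × (∀ i j → adj 2K2 i j ≡ adj G (f i) (f j))

record IsSplitPartition (G : Graph) (p : Fin (n G) → Part) : Set where
  field
    clique      : ∀ u v → u ≢ v → p u ≡ inC → p v ≡ inC → adj G u v ≡ true
    independent : ∀ u v → p u ≡ inI → p v ≡ inI → adj G u v ≡ false
    S-shape     : (∀ v → p v ≢ inS) ⊎ Induces2K2 G p
    C-S-full    : ∀ u v → p u ≡ inC → p v ≡ inS → adj G u v ≡ true
    I-S-empty   : ∀ u v → p u ≡ inI → p v ≡ inS → adj G u v ≡ false

Is2K2Split : Graph → Set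
Is2K2Split G = Σ (Fin (n G) → Part) λ p → IsSplitPartition G p

-- A 2K2-split partition assigns each vertex a role: clique, independent, or one of
-- the four positions of the 2K2 on S. Roles pull back along induced embeddings, and
-- a finite search shows that none of the seven graphs admits them.
--
-- Conversely, let G avoid the seven graphs. If G induces a 2K2 on S, then K2+P3, P5,
-- the co-banner and K2+K3 force every other vertex to see all of S or none of it;
-- the vertices seeing S form a clique (no C4), the others an independent set (no 3K2).
-- If G induces no 2K2 it is split (Földes–Hammer): a split partition in which every
-- independent vertex misses some clique vertex is extended one vertex at a time, and
-- 2K2, C4 and C5 rule out the cases where the new vertex cannot be placed after
-- moving at most two old vertices across the partition.
module Submission where

open import Defs
open import Data.Product using (_×_)
open import Function.Bundles using (_⇔_; mk⇔)

open import Data.Bool using (Bool; true; false; not; _∧_; if_then_else_)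
open import Data.Bool.ListAction using (any)
open import Data.Bool.Properties using (⇔→≡; ¬-not) renaming (_≟_ to _≟ᵇ_)
open import Data.Empty using (⊥; ⊥-elim)
open import Data.Fin as Fin using (Fin; zero; suc; toℕ; fromℕ<)
open import Data.Fin.Properties
  using (<-cmp; all?; any?; suc-injective; toℕ<n; toℕ-fromℕ<; toℕ-injective)
  renaming (_≟_ to _≟ᶠ_)
open import Data.List using (List; []; _∷_; _++_; map; filter; allFin)
open import Data.List.Membership.Propositional using (_∈_)
open import Data.List.Membership.Propositional.Properties
  using (∈-++⁺ˡ; ∈-++⁺ʳ; ∈-map⁺; ∈-filter⁺; ∈-allFin)
open import Data.List.Relation.Unary.All as All using (All; []; _∷_)
open import Data.List.Relation.Unary.Any using (here; there)
open import Data.Nat as ℕ using (ℕ; zero; suc; s≤s)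
open import Data.Nat.Properties using (<-irrefl; ≤-refl; ≤-trans; n≤1+n; m<1+n⇒m<n∨m≡n; _<?_)
import Data.Product as Prod
open import Data.Product using (Σ; ∃; _,_; proj₁)
open import Data.Sum using (_⊎_; inj₁; inj₂)
open import Data.Vec using (Vec; _∷_; []; lookup)
open import Function using (_∘_; case_of_)
open import Function.Definitions using (Injective)
open import Relation.Binary using (tri<; tri≈; tri>)
open import Relation.Binary.PropositionalEquality
  using (_≡_; _≢_; ≢-sym; refl; trans; cong) renaming (sym to ≡-sym)
open import Relation.Nullary using (¬_; Dec; yes; no; does)
open import Relation.Nullary.Decidable using (dec-true; dec-false; _×-dec_; ¬?)

∧-true : ∀ {a b} → a ≡ true → b ≡ true → a ∧ b ≡ true
∧-true refl refl = refl

true≢false : true ≢ false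
true≢false ()

any-∈ : ∀ {A : Set} {p : A → Bool} {x xs} → x ∈ xs → p x ≡ true → any p xs ≡ true
any-∈ (here refl) px rewrite px = refl
any-∈ {p = p} {xs = y ∷ _} (there x∈xs) px with p y
... | true = refl
... | false = any-∈ x∈xs px

orderedPairs : (k : ℕ) → List (Fin k × Fin k)
orderedPairs zero = []
orderedPairs (suc k) =
  map (λ j → zero , suc j) (allFin k) ++ map (Prod.map suc suc) (orderedPairs k)

∈-orderedPairs : ∀ {k} {i j : Fin k} → i Fin.< j → (i , j) ∈ orderedPairs k
∈-orderedPairs {suc k} {zero} {suc j} _ = ∈-++⁺ˡ (∈-map⁺ _ (∈-allFin j))
∈-orderedPairs {suc k} {suc i} {suc j} (s≤s i<j) =
  ∈-++⁺ʳ _ (∈-map⁺ (Prod.map suc suc) (∈-orderedPairs i<j))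

Twins : (H : Graph) → Fin (n H) → Fin (n H) → Set
Twins H i j = ∀ l → adj H i l ≡ adj H j l

twinPairs : (H : Graph) → List (Fin (n H) × Fin (n H))
twinPairs H = filter (λ (i , j) → all? (λ l → adj H i l ≟ᵇ adj H j l)) (orderedPairs (n H))

module _ (H G : Graph) (f : Fin (n H) → Fin (n G)) where
  Matches : Set
  Matches = All (λ (i , j) → adj G (f i) (f j) ≡ adj H i j) (orderedPairs (n H))

  SeparatesTwins : Set
  SeparatesTwins = All (λ (i , j) → f i ≢ f j) (twinPairs H)

module _ {H G : Graph} {f : Fin (n H) → Fin (n G)} (m : Matches H G f) where
  matches⇒adj : ∀ i j → adj H i j ≡ adj G (f i) (f j)
  matches⇒adj i j with <-cmp i j
  ... | tri< i<j _ _ = ≡-sym (All.lookup m (∈-orderedPairs i<j))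
  ... | tri≈ _ refl _ = trans (irrefl H i) (≡-sym (irrefl G (f i)))
  ... | tri> _ _ j<i =
    trans (sym H i j) (trans (≡-sym (All.lookup m (∈-orderedPairs j<i))) (sym G (f j) (f i)))

  collapsed⇒twins : ∀ {i j} → f i ≡ f j → Twins H i j
  collapsed⇒twins {i} {j} fi≡fj l =
    trans (matches⇒adj i l) (trans (cong (λ x → adj G x (f l)) fi≡fj) (≡-sym (matches⇒adj j l)))

  matches⇒injective : SeparatesTwins H G f → Injective _≡_ _≡_ f
  matches⇒injective sep {i} {j} fi≡fj with <-cmp i j
  ... | tri≈ _ i≡j _ = i≡j
  ... | tri< i<j _ _ =
    ⊥-elim (All.lookup sep (∈-filter⁺ _ (∈-orderedPairs i<j) (collapsed⇒twins fi≡fj)) fi≡fj)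
  ... | tri> _ _ j<i =
    ⊥-elim (All.lookup sep (∈-filter⁺ _ (∈-orderedPairs j<i) (collapsed⇒twins (≡-sym fi≡fj)))
                       (≡-sym fi≡fj))

-- Adjacencies are listed for the pairs (0,1), (0,2), …, (1,2), … in this order;
-- distinctness is required only for the twins of H.
inducedBy : ∀ {H G} (xs : Vec (Fin (n G)) (n H)) →
            Matches H G (lookup xs) → SeparatesTwins H G (lookup xs) → InducedSub H G
inducedBy {H} {G} xs m sep = record
  { emb = lookup xs ; emb-inj = matches⇒injective {H} {G} m sep ; emb-adj = matches⇒adj {H} {G} m }

-- Roles in a 2K2-split partition

data Role : Set where
  roleC roleI : Role
  roleS : Fin 4 → Role

roles : List Role
roles = roleC ∷ roleI ∷ map roleS (allFin 4)

∈-roles : ∀ r → r ∈ roles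
∈-roles roleC = here refl
∈-roles roleI = there (here refl)
∈-roles (roleS i) = there (there (∈-map⁺ roleS (∈-allFin i)))

-- fits r s b: distinct vertices of roles r and s may be adjacent (b = true) or not
-- (b = false); roleS i is the vertex at position i of the 2K2 induced on S.
fits : Role → Role → Bool → Bool
fits roleC roleC b = b
fits roleC roleI _ = true
fits roleC (roleS _) b = b
fits roleI roleC _ = true
fits roleI roleI b = not b
fits roleI (roleS _) b = not b
fits (roleS _) roleC b = b
fits (roleS _) roleI b = not b
fits (roleS i) (roleS j) b = not (does (i ≟ᶠ j)) ∧ does (b ≟ᵇ adj 2K2 i j)

IsRoleMap : (G : Graph) → (Fin (n G) → Role) → Set
IsRoleMap G r = ∀ u v → u ≢ v → fits (r u) (r v) (adj G u v) ≡ true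

roleMap-restrict : ∀ {H G r} (E : InducedSub H G) → IsRoleMap G r →
                   IsRoleMap H (r ∘ InducedSub.emb E)
roleMap-restrict {r = r} E rm i j i≢j =
  trans (cong (fits (r (emb i)) (r (emb j))) (emb-adj i j)) (rm (emb i) (emb j) (i≢j ∘ emb-inj))
  where open InducedSub E

module _ {G : Graph} {p : Fin (n G) → Part} (sp : IsSplitPartition G p) where
  open IsSplitPartition sp

  slot : ∀ v → p v ≡ inS → Fin 4
  slot v e with S-shape
  ... | inj₁ noS = ⊥-elim (noS v e)
  ... | inj₂ (_ , _ , _ , onto , _) = proj₁ (onto v e)

  slots-fit : ∀ u v (eu : p u ≡ inS) (ev : p v ≡ inS) → u ≢ v →
              fits (roleS (slot u eu)) (roleS (slot v ev)) (adj G u v) ≡ true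
  slots-fit u v eu ev u≢v with S-shape
  ... | inj₁ noS = ⊥-elim (noS u eu)
  ... | inj₂ (f , _ , _ , onto , f-adj) with onto u eu | onto v ev
  ... | i , refl | j , refl =
    ∧-true (cong not (dec-false (i ≟ᶠ j) (u≢v ∘ cong f)))
           (dec-true (adj G (f i) (f j) ≟ᵇ adj 2K2 i j) (≡-sym (f-adj i j)))

  roleOf : ∀ v q → p v ≡ q → Role
  roleOf v inC _ = roleC
  roleOf v inI _ = roleI
  roleOf v inS e = roleS (slot v e)

  roleOf-fits : ∀ u v qu qv (eu : p u ≡ qu) (ev : p v ≡ qv) → u ≢ v →
                fits (roleOf u qu eu) (roleOf v qv ev) (adj G u v) ≡ true
  roleOf-fits u v inC inC eu ev u≢v = clique u v u≢v eu ev
  roleOf-fits u v inC inI eu ev u≢v = refl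
  roleOf-fits u v inC inS eu ev u≢v = C-S-full u v eu ev
  roleOf-fits u v inI inC eu ev u≢v = refl
  roleOf-fits u v inI inI eu ev u≢v = cong not (independent u v eu ev)
  roleOf-fits u v inI inS eu ev u≢v = cong not (I-S-empty u v eu ev)
  roleOf-fits u v inS inC eu ev u≢v = trans (sym G u v) (C-S-full v u ev eu)
  roleOf-fits u v inS inI eu ev u≢v = cong not (trans (sym G u v) (I-S-empty v u ev eu))
  roleOf-fits u v inS inS eu ev u≢v = slots-fit u v eu ev u≢v

split⇒roleMap : ∀ {G} → Is2K2Split G → ∃ (IsRoleMap G)
split⇒roleMap (p , sp) =
  (λ v → roleOf sp v (p v) refl) , (λ u v → roleOf-fits sp u v (p u) (p v) refl refl)

-- Backtracking search: the role chosen for vertex zero restricts the roles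
-- allowed for the remaining vertices.
extensible : ∀ k → (Fin k → Fin k → Bool) → (Fin k → Role → Bool) → Bool

placeFirst : ∀ {k} → (Fin (suc k) → Fin (suc k) → Bool) → (Fin (suc k) → Role → Bool) →
             Role → Bool
placeFirst {k} a allowed r =
  allowed zero r ∧ extensible k (λ i j → a (suc i) (suc j))
                                (λ j s → allowed (suc j) s ∧ fits r s (a zero (suc j)))

extensible zero _ _ = true
extensible (suc k) a allowed = any (placeFirst a allowed) roles

extensible-complete : ∀ k a allowed (r : Fin k → Role) →
  (∀ i → allowed i (r i) ≡ true) → (∀ i j → i ≢ j → fits (r i) (r j) (a i j) ≡ true) →
  extensible k a allowed ≡ true
extensible-complete zero _ _ _ _ _ = refl
extensible-complete (suc k) a allowed r allowed-r fits-r =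
  any-∈ {p = placeFirst a allowed} (∈-roles (r zero))
    (∧-true (allowed-r zero)
      (extensible-complete k _ _ (r ∘ suc)
        (λ j → ∧-true (allowed-r (suc j)) (fits-r zero (suc j) λ ()))
        (λ i j i≢j → fits-r (suc i) (suc j) (i≢j ∘ suc-injective))))

split⇒free : ∀ {G} H → extensible (n H) (adj H) (λ _ _ → true) ≡ false → Is2K2Split G → Free H G
split⇒free H noRoleMap split E with split⇒roleMap split
... | r , rm = true≢false (trans (≡-sym roleMapFound) noRoleMap)
  where
  roleMapFound : extensible (n H) (adj H) (λ _ _ → true) ≡ true
  roleMapFound = extensible-complete (n H) (adj H) _ (r ∘ InducedSub.emb E) (λ _ → refl)
                                     (roleMap-restrict {r = r} E rm)

split⇒forbiddenFree : ∀ {G} → Is2K2Split G →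
  Free C4 G × Free C5 G × Free K2+P3 G × Free K2+K3 G × Free P5 G × Free coBanner G × Free 3K2 G
split⇒forbiddenFree s =
  split⇒free C4 refl s , split⇒free C5 refl s , split⇒free K2+P3 refl s , split⇒free K2+K3 refl s ,
  split⇒free P5 refl s , split⇒free coBanner refl s , split⇒free 3K2 refl s

-- Graphs with an induced 2K2

module _ {G : Graph} where
  private
    V = Fin (n G)
    A = adj G

  _˘ : ∀ {x y b} → A x y ≡ b → A y x ≡ b
  _˘ {x} {y} e = trans (sym G y x) e

  distinguishedBy : ∀ {x y} (f : V → Bool) → f x ≡ true → f y ≡ false → x ≢ y
  distinguishedBy f fx fy refl = true≢false (trans (≡-sym fx) fy)

  Is2K2 : V → V → V → V → Set
  Is2K2 a b c d = A a b ≡ true × A c d ≡ true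
                × A a c ≡ false × A a d ≡ false × A b c ≡ false × A b d ≡ false

  is2K2? : ∀ a b c d → Dec (Is2K2 a b c d)
  is2K2? a b c d = (A a b ≟ᵇ true) ×-dec (A c d ≟ᵇ true) ×-dec (A a c ≟ᵇ false)
                   ×-dec (A a d ≟ᵇ false) ×-dec (A b c ≟ᵇ false) ×-dec (A b d ≟ᵇ false)

  2K2-swapˡ : ∀ {a b c d} → Is2K2 a b c d → Is2K2 b a c d
  2K2-swapˡ (ab , cd , ac , ad , bc , bd) = ab ˘ , cd , bc , bd , ac , ad

  2K2-flip : ∀ {a b c d} → Is2K2 a b c d → Is2K2 c d a b
  2K2-flip (ab , cd , ac , ad , bc , bd) = cd , ab , ac ˘ , bc ˘ , ad ˘ , bd ˘

  module Homogeneous (fK2P3 : Free K2+P3 G) (fP5 : Free P5 G) (fCB : Free coBanner G)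
                     (fK2K3 : Free K2+K3 G) where

    -- A neighbour of one end of an edge of the 2K2 sees the other end: otherwise
    -- K2+P3, P5 or the co-banner is induced, according to which of c, d it sees.
    partner-adj : ∀ {a b c d v} → Is2K2 a b c d → v ≢ b → A v a ≡ true → A v b ≡ true
    partner-adj {a} {b} {c} {d} {v} (ab , cd , ac , ad , bc , bd) v≢b va
      with A v b in vb | A v c in vc | A v d in vd
    ... | true | _ | _ = refl
    ... | false | false | false = ⊥-elim (fK2P3 (inducedBy (c ∷ d ∷ b ∷ a ∷ v ∷ [])
          (cd ∷ bc ˘ ∷ ac ˘ ∷ vc ˘ ∷ bd ˘ ∷ ad ˘ ∷ vd ˘ ∷ ab ˘ ∷ vb ˘ ∷ va ˘ ∷ [])
          ((v≢b ∘ ≡-sym) ∷ [])))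
    ... | false | true | false = ⊥-elim (fP5 (inducedBy (b ∷ a ∷ v ∷ c ∷ d ∷ [])
          (ab ˘ ∷ vb ˘ ∷ bc ∷ bd ∷ va ˘ ∷ ac ∷ ad ∷ vc ∷ vd ∷ cd ∷ []) []))
    ... | false | false | true = ⊥-elim (fP5 (inducedBy (b ∷ a ∷ v ∷ d ∷ c ∷ [])
          (ab ˘ ∷ vb ˘ ∷ bd ∷ bc ∷ va ˘ ∷ ad ∷ ac ∷ vd ∷ vc ∷ cd ˘ ∷ []) []))
    ... | false | true | true = ⊥-elim (fCB (inducedBy (v ∷ a ∷ b ∷ c ∷ d ∷ [])
          (va ∷ vb ∷ vc ∷ vd ∷ ab ∷ ac ∷ ad ∷ bc ∷ bd ∷ cd ∷ []) []))

    same-adj-partner : ∀ {a b c d v} → Is2K2 a b c d → v ≢ a → v ≢ b → A v a ≡ A v b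
    same-adj-partner t v≢a v≢b =
      ⇔→≡ (mk⇔ (partner-adj t v≢b) (partner-adj (2K2-swapˡ t) v≢a))

    -- A vertex seeing the edge ab but not cd induces K2+K3 together with the 2K2.
    sees-across : ∀ {a b c d v} → Is2K2 a b c d → v ≢ b → v ≢ c → v ≢ d →
                  A v a ≡ true → A v c ≡ true
    sees-across {a} {b} {c} {d} {v} t@(ab , cd , ac , ad , bc , bd) v≢b v≢c v≢d va
      with A v c in vc
    ... | true = refl
    ... | false = ⊥-elim (fK2K3 (inducedBy (c ∷ d ∷ a ∷ b ∷ v ∷ [])
          (cd ∷ ac ˘ ∷ bc ˘ ∷ vc ˘ ∷ ad ˘ ∷ bd ˘ ∷ vd ˘ ∷ ab ∷ va ˘ ∷ vb ˘ ∷ []) []))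
      where
      vb : A v b ≡ true
      vb = partner-adj t v≢b va
      vd : A v d ≡ false
      vd = trans (≡-sym (same-adj-partner (2K2-flip t) v≢c v≢d)) vc

    same-adj-across : ∀ {a b c d v} → Is2K2 a b c d → v ≢ a → v ≢ b → v ≢ c → v ≢ d →
                      A v a ≡ A v c
    same-adj-across t v≢a v≢b v≢c v≢d =
      ⇔→≡ (mk⇔ (sees-across t v≢b v≢c v≢d) (sees-across (2K2-flip t) v≢d v≢a v≢b))

  module AroundInduced2K2 (fC4 : Free C4 G) (fK2P3 : Free K2+P3 G) (fK2K3 : Free K2+K3 G)
                          (fP5 : Free P5 G) (fCB : Free coBanner G) (f3K2 : Free 3K2 G)
                          {a b c d : V} (ab : A a b ≡ true) (cd : A c d ≡ true)
                          (ac : A a c ≡ false) (ad : A a d ≡ false)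
                          (bc : A b c ≡ false) (bd : A b d ≡ false) where
    open Homogeneous fK2P3 fP5 fCB fK2K3

    t : Is2K2 a b c d
    t = ab , cd , ac , ad , bc , bd

    E : InducedSub 2K2 G
    E = inducedBy (a ∷ b ∷ c ∷ d ∷ []) (ab ∷ ac ∷ ad ∷ bc ∷ bd ∷ cd ∷ []) []

    open InducedSub E

    InS : V → Set
    InS v = ∃ λ i → emb i ≡ v

    inS? : ∀ v → Dec (InS v)
    inS? v = any? (λ i → emb i ≟ᶠ v)

    homogeneous : ∀ {v} → ¬ InS v → ∀ i → A v (emb i) ≡ A v a
    homogeneous {v} v∉S = at
      where
      ≢ : ∀ i → v ≢ emb i
      ≢ i e = v∉S (i , ≡-sym e)
      at : ∀ i → A v (emb i) ≡ A v a
      at zero = refl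
      at (suc zero) = ≡-sym (same-adj-partner t (≢ zero) (≢ (suc zero)))
      at (suc (suc zero)) =
        ≡-sym (same-adj-across t (≢ zero) (≢ (suc zero)) (≢ (suc (suc zero))) (≢ (suc (suc (suc zero)))))
      at (suc (suc (suc zero))) =
        trans (≡-sym (same-adj-partner (2K2-flip t) (≢ (suc (suc zero))) (≢ (suc (suc (suc zero))))))
              (at (suc (suc zero)))

    part : V → Part
    part v with inS? v | A v a
    ... | yes _ | _ = inS
    ... | no _ | true = inC
    ... | no _ | false = inI

    part≡inS : ∀ {v} → part v ≡ inS → InS v
    part≡inS {v} e with inS? v | A v a
    part≡inS {v} refl | yes v∈S | _ = v∈S
    part≡inS {v} () | no _ | true
    part≡inS {v} () | no _ | false

    part≡inC : ∀ {v} → part v ≡ inC → ∀ i → A v (emb i) ≡ true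
    part≡inC {v} e with inS? v | A v a in va
    part≡inC {v} () | yes _ | _
    part≡inC {v} refl | no v∉S | true = λ i → trans (homogeneous v∉S i) va
    part≡inC {v} () | no _ | false

    part≡inI : ∀ {v} → part v ≡ inI → ∀ i → A v (emb i) ≡ false
    part≡inI {v} e with inS? v | A v a in va
    part≡inI {v} () | yes _ | _
    part≡inI {v} () | no _ | true
    part≡inI {v} refl | no v∉S | false = λ i → trans (homogeneous v∉S i) va

    emb-inS : ∀ i → part (emb i) ≡ inS
    emb-inS i with inS? (emb i)
    ... | yes _ = refl
    ... | no ∉S = ⊥-elim (∉S (i , refl))

    C-clique : ∀ u v → u ≢ v → part u ≡ inC → part v ≡ inC → A u v ≡ true
    C-clique u v u≢v eu ev = ¬-not λ uv → fC4 (inducedBy (u ∷ a ∷ v ∷ c ∷ [])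
      (uS zero ∷ uv ∷ uS (suc (suc zero)) ∷ vS zero ˘ ∷ ac ∷ vS (suc (suc zero)) ∷ [])
      (u≢v ∷ distinguishedBy (λ x → A x b) ab (bc ˘) ∷ []))
      where uS = part≡inC eu
            vS = part≡inC ev

    I-independent : ∀ u v → part u ≡ inI → part v ≡ inI → A u v ≡ false
    I-independent u v eu ev = ¬-not λ uv → f3K2 (inducedBy (u ∷ v ∷ a ∷ b ∷ c ∷ d ∷ [])
      (uv ∷ uS zero ∷ uS (suc zero) ∷ uS (suc (suc zero)) ∷ uS (suc (suc (suc zero)))
          ∷ vS zero ∷ vS (suc zero) ∷ vS (suc (suc zero)) ∷ vS (suc (suc (suc zero)))
          ∷ ab ∷ ac ∷ ad ∷ bc ∷ bd ∷ cd ∷ []) [])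
      where uS = part≡inI eu
            vS = part≡inI ev

    split : Is2K2Split G
    split = part , record
      { clique = C-clique
      ; independent = I-independent
      ; S-shape = inj₂ (emb , emb-inj , emb-inS , (λ v → part≡inS) , emb-adj)
      ; C-S-full = λ u v eu ev → case part≡inS ev of λ { (i , refl) → part≡inC eu i }
      ; I-S-empty = λ u v eu ev → case part≡inS ev of λ { (i , refl) → part≡inI eu i }
      }

  -- Split partitions of vertex subsets

  record SplitOn (D : V → Set) (q : V → Bool) : Set where
    field
      clique      : ∀ {u v} → D u → D v → u ≢ v → q u ≡ true → q v ≡ true → A u v ≡ true
      independent : ∀ {u v} → D u → D v → q u ≡ false → q v ≡ false → A u v ≡ false

  Misses : (V → Set) → (V → Bool) → V → Set
  Misses D q i = ∃ λ c → D c × q c ≡ true × A i c ≡ false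

  Saturated : (V → Set) → (V → Bool) → Set
  Saturated D q = ∀ {i} → D i → q i ≡ false → Misses D q i

  opaque
    _[_≔_] : (V → Bool) → V → Bool → V → Bool
    (q [ x ≔ b ]) v = if does (v ≟ᶠ x) then b else q v

    update-at : ∀ q x b → (q [ x ≔ b ]) x ≡ b
    update-at q x b rewrite dec-true (x ≟ᶠ x) refl = refl

    update-cases : ∀ {q x b v r} → (q [ x ≔ b ]) v ≡ r → (v ≡ x × b ≡ r) ⊎ (v ≢ x × q v ≡ r)
    update-cases {x = x} {v = v} e with v ≟ᶠ x
    ... | yes v≡x = inj₁ (v≡x , e)
    ... | no v≢x = inj₂ (v≢x , e)

  misses? : ∀ {D} → (∀ v → Dec (D v)) → ∀ q i → Dec (Misses D q i)
  misses? D? q i = any? (λ c → D? c ×-dec (q c ≟ᵇ true) ×-dec (A i c ≟ᵇ false))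

  -- Moving one independent vertex that sees the whole clique into the clique
  -- saturates: every other independent vertex misses the moved one.
  saturate : ∀ {D} → (∀ v → Dec (D v)) → ∀ {q} → SplitOn D q →
             Σ (V → Bool) λ q′ → SplitOn D q′ × Saturated D q′
  saturate {D} D? {q} sp with any? (λ i → D? i ×-dec (q i ≟ᵇ false) ×-dec ¬? (misses? D? q i))
  ... | no none = q , sp , saturated
    where
    saturated : Saturated D q
    saturated {i} Di qi with misses? D? q i
    ... | yes m = m
    ... | no ¬m = ⊥-elim (none (i , Di , qi , ¬m))
  ... | yes (i , Di , qi , ¬mi) = q [ i ≔ true ] , split′ , saturated
    where
    open SplitOn sp
    split′ : SplitOn D (q [ i ≔ true ])
    split′ .SplitOn.clique Du Dv u≢v eu ev with update-cases eu | update-cases ev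
    ... | inj₁ (refl , _) | inj₁ (refl , _) = ⊥-elim (u≢v refl)
    ... | inj₁ (refl , _) | inj₂ (_ , qv) = ¬-not (λ iv → ¬mi (_ , Dv , qv , iv))
    ... | inj₂ (_ , qu) | inj₁ (refl , _) = ¬-not (λ iu → ¬mi (_ , Du , qu , iu)) ˘
    ... | inj₂ (_ , qu) | inj₂ (_ , qv) = clique Du Dv u≢v qu qv
    split′ .SplitOn.independent Du Dv eu ev with update-cases eu | update-cases ev
    ... | inj₁ (_ , ()) | _
    ... | inj₂ _ | inj₁ (_ , ())
    ... | inj₂ (_ , qu) | inj₂ (_ , qv) = independent Du Dv qu qv
    saturated : Saturated D (q [ i ≔ true ])
    saturated {j} Dj qj with update-cases qj
    ... | inj₁ (_ , ())
    ... | inj₂ (_ , qj′) = i , Di , update-at q i true , independent Dj Di qj′ qi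

  splitOn-⊆ : ∀ {D₁ D₂ q} → (∀ {u} → D₂ u → D₁ u) → SplitOn D₁ q → SplitOn D₂ q
  splitOn-⊆ D₂⊆D₁ sp = record
    { clique = λ Du Dv → clique (D₂⊆D₁ Du) (D₂⊆D₁ Dv)
    ; independent = λ Du Dv → independent (D₂⊆D₁ Du) (D₂⊆D₁ Dv) }
    where open SplitOn sp

  module Extend (no2K2 : ∀ {a b c d} → ¬ Is2K2 a b c d) (fC4 : Free C4 G) (fC5 : Free C5 G)
                {D : V → Set} (D? : ∀ v → Dec (D v)) {q : V → Bool}
                (sp : SplitOn D q) (sat : Saturated D q) {w : V} (w∉D : ¬ D w) where
    open SplitOn sp

    D⁺ : V → Set
    D⁺ u = D u ⊎ u ≡ w

    old : ∀ {u} → D⁺ u → u ≢ w → D u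
    old (inj₁ Du) _ = Du
    old (inj₂ u≡w) u≢w = ⊥-elim (u≢w u≡w)

    ≢w : ∀ {u} → D u → u ≢ w
    ≢w Du refl = w∉D Du

    noC4-through : ∀ {β c x} → D β → q β ≡ false → A w β ≡ true →
                   D c → q c ≡ true → A β c ≡ false → A w c ≡ true →
                   D x → q x ≡ true → A w x ≡ false → A β x ≡ true → ⊥
    noC4-through Dβ qβ wβ Dc qc βc wc Dx qx wx βx = fC4 (inducedBy (_ ∷ w ∷ _ ∷ _ ∷ [])
      (wβ ˘ ∷ βc ∷ βx ∷ wc ∷ wx ∷ clique Dc Dx (≢-sym (distinguishedBy (A _) βx βc)) qc qx ∷ [])
      (≢-sym (distinguishedBy q qc qβ) ∷ ≢-sym (≢w Dx) ∷ []))

    joinClique : (∀ {c} → D c → q c ≡ true → A w c ≡ true) → Σ (V → Bool) (SplitOn D⁺)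
    joinClique w-sees = q [ w ≔ true ] , split′
      where
      split′ : SplitOn D⁺ (q [ w ≔ true ])
      split′ .SplitOn.clique Du Dv u≢v eu ev with update-cases eu | update-cases ev
      ... | inj₁ (refl , _) | inj₁ (refl , _) = ⊥-elim (u≢v refl)
      ... | inj₁ (refl , _) | inj₂ (v≢w , qv) = w-sees (old Dv v≢w) qv
      ... | inj₂ (u≢w , qu) | inj₁ (refl , _) = w-sees (old Du u≢w) qu ˘
      ... | inj₂ (u≢w , qu) | inj₂ (v≢w , qv) = clique (old Du u≢w) (old Dv v≢w) u≢v qu qv
      split′ .SplitOn.independent Du Dv eu ev with update-cases eu | update-cases ev
      ... | inj₁ (_ , ()) | _
      ... | inj₂ _ | inj₁ (_ , ())
      ... | inj₂ (u≢w , qu) | inj₂ (v≢w , qv) = independent (old Du u≢w) (old Dv v≢w) qu qv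

    joinIndependent : (∀ {i} → D i → q i ≡ false → A w i ≡ false) → Σ (V → Bool) (SplitOn D⁺)
    joinIndependent w-misses = q [ w ≔ false ] , split′
      where
      split′ : SplitOn D⁺ (q [ w ≔ false ])
      split′ .SplitOn.clique Du Dv u≢v eu ev with update-cases eu | update-cases ev
      ... | inj₁ (_ , ()) | _
      ... | inj₂ _ | inj₁ (_ , ())
      ... | inj₂ (u≢w , qu) | inj₂ (v≢w , qv) = clique (old Du u≢w) (old Dv v≢w) u≢v qu qv
      split′ .SplitOn.independent Du Dv eu ev with update-cases eu | update-cases ev
      ... | inj₁ (refl , _) | inj₁ (refl , _) = irrefl G w
      ... | inj₁ (refl , _) | inj₂ (v≢w , qv) = w-misses (old Dv v≢w) qv
      ... | inj₂ (u≢w , qu) | inj₁ (refl , _) = w-misses (old Du u≢w) qu ˘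
      ... | inj₂ (u≢w , qu) | inj₂ (v≢w , qv) = independent (old Du u≢w) (old Dv v≢w) qu qv

    -- w joins the clique and a, its only non-neighbour there, leaves it.
    module TradeWithOnlyMissed {a} (Da : D a) (qa : q a ≡ true) (wa : A w a ≡ false)
                               {b} (Db : D b) (qb : q b ≡ false) (wb : A w b ≡ true)
                               (only : ∀ {c} → D c → q c ≡ true → c ≢ a → A w c ≡ true) where

      no-common-neighbour : ∀ {β} → D β → q β ≡ false → A w β ≡ true → A a β ≡ true → ⊥
      no-common-neighbour Dβ qβ wβ aβ with sat Dβ qβ
      ... | c , Dc , qc , βc =
        noC4-through Dβ qβ wβ Dc qc βc (only Dc qc (distinguishedBy (A _) (aβ ˘) βc ∘ ≡-sym))
                     Da qa wa (aβ ˘)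

      a-isolated : ∀ {i} → D i → q i ≡ false → A a i ≡ false
      a-isolated {i} Di qi = ¬-not λ ai →
        no-common-neighbour Di qi (¬-not λ wi →
          no-common-neighbour Db qb wb (¬-not λ ab →
            no2K2 (wb , ai , wa , wi , ab ˘ , independent Db Di qb qi))) ai

      q′ : V → Bool
      q′ = q [ w ≔ true ] [ a ≔ false ]

      data Status (u : V) (r : Bool) : Set where
        moved-a : u ≡ a → false ≡ r → Status u r
        added-w : u ≡ w → true ≡ r → Status u r
        kept    : D u → u ≢ a → q u ≡ r → Status u r

      status : ∀ {u r} → D⁺ u → q′ u ≡ r → Status u r
      status Du e with update-cases e
      ... | inj₁ (u≡a , r) = moved-a u≡a r
      ... | inj₂ (u≢a , e′) with update-cases e′
      ... | inj₁ (u≡w , r) = added-w u≡w r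
      ... | inj₂ (u≢w , qu) = kept (old Du u≢w) u≢a qu

      split′ : SplitOn D⁺ q′
      split′ .SplitOn.clique Du Dv u≢v eu ev with status Du eu | status Dv ev
      ... | moved-a _ () | _
      ... | added-w _ _ | moved-a _ ()
      ... | kept _ _ _ | moved-a _ ()
      ... | added-w refl _ | added-w refl _ = ⊥-elim (u≢v refl)
      ... | added-w refl _ | kept Dv′ v≢a qv = only Dv′ qv v≢a
      ... | kept Du′ u≢a qu | added-w refl _ = only Du′ qu u≢a ˘
      ... | kept Du′ _ qu | kept Dv′ _ qv = clique Du′ Dv′ u≢v qu qv

      split′ .SplitOn.independent Du Dv eu ev with status Du eu | status Dv ev
      ... | added-w _ () | _
      ... | moved-a _ _ | added-w _ ()
      ... | kept _ _ _ | added-w _ ()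
      ... | moved-a refl _ | moved-a refl _ = irrefl G a
      ... | moved-a refl _ | kept Dv′ _ qv = a-isolated Dv′ qv
      ... | kept Du′ _ qu | moved-a refl _ = a-isolated Du′ qu ˘
      ... | kept Du′ _ qu | kept Dv′ _ qv = independent Du′ Dv′ qu qv

      trade : Σ (V → Bool) (SplitOn D⁺)
      trade = q′ , split′

    -- b is w's only independent neighbour; b joins the clique while c, a clique
    -- vertex missed by b, and w become independent.
    module TradeThroughNeighbour {a} (Da : D a) (qa : q a ≡ true) (wa : A w a ≡ false)
                                 {a′} (Da′ : D a′) (qa′ : q a′ ≡ true) (wa′ : A w a′ ≡ false)
                                 (a′≢a : a′ ≢ a)
                                 {b} (Db : D b) (qb : q b ≡ false) (wb : A w b ≡ true)
                                 {c} (Dc : D c) (qc : q c ≡ true) (bc : A b c ≡ false) where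

      sees-a-or-a′ : ∀ {β} → A w β ≡ true → A β a ≡ true ⊎ A β a′ ≡ true
      sees-a-or-a′ {β} wβ with A β a in βa | A β a′ in βa′
      ... | true | _ = inj₁ refl
      ... | false | true = inj₂ refl
      ... | false | false =
        ⊥-elim (no2K2 (wβ , clique Da Da′ (≢-sym a′≢a) qa qa′ , wa , wa′ , βa , βa′))

      w-misses : ∀ {β c′} → D β → q β ≡ false → A w β ≡ true → D c′ → q c′ ≡ true →
                 A β c′ ≡ false → A w c′ ≡ false
      w-misses Dβ qβ wβ Dc′ qc′ βc′ = ¬-not λ wc′ → case sees-a-or-a′ wβ of λ where
        (inj₁ βa) → noC4-through Dβ qβ wβ Dc′ qc′ βc′ wc′ Da qa wa βa
        (inj₂ βa′) → noC4-through Dβ qβ wβ Dc′ qc′ βc′ wc′ Da′ qa′ wa′ βa′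

      sees-rest : ∀ {β cβ c′} → D β → q β ≡ false → A w β ≡ true → D cβ → q cβ ≡ true →
                  A β cβ ≡ false → D c′ → q c′ ≡ true → c′ ≢ cβ → A β c′ ≡ true
      sees-rest Dβ qβ wβ Dcβ qcβ βcβ Dc′ qc′ c′≢cβ = ¬-not λ βc′ →
        no2K2 (wβ , clique Dc′ Dcβ c′≢cβ qc′ qcβ , w-misses Dβ qβ wβ Dc′ qc′ βc′ ,
               w-misses Dβ qβ wβ Dcβ qcβ βcβ , βc′ , βcβ)

      wc : A w c ≡ false
      wc = w-misses Db qb wb Dc qc bc

      missed-besides-c : ∃ λ x → D x × q x ≡ true × A w x ≡ false × x ≢ c
      missed-besides-c with a ≟ᶠ c
      ... | yes refl = a′ , Da′ , qa′ , wa′ , a′≢a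
      ... | no a≢c = a , Da , qa , wa , a≢c

      -- Another independent neighbour β of w, missing c′, induces a C4 if c′ = c
      -- and the C5 b w β c c′ otherwise.
      unique-neighbour : ∀ {β} → D β → q β ≡ false → A w β ≡ true → β ≡ b
      unique-neighbour {β} Dβ qβ wβ with β ≟ᶠ b | sat Dβ qβ
      ... | yes β≡b | _ = β≡b
      ... | no β≢b | c′ , Dc′ , qc′ , βc′ with c ≟ᶠ c′
      ... | no c≢c′ = ⊥-elim (fC5 (inducedBy (b ∷ w ∷ β ∷ c ∷ c′ ∷ [])
            (wb ˘ ∷ independent Db Dβ qb qβ ∷ bc ∷ sees-rest Db qb wb Dc qc bc Dc′ qc′ (≢-sym c≢c′)
             ∷ wβ ∷ wc ∷ w-misses Dβ qβ wβ Dc′ qc′ βc′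
             ∷ sees-rest Dβ qβ wβ Dc′ qc′ βc′ Dc qc c≢c′ ∷ βc′
             ∷ clique Dc Dc′ c≢c′ qc qc′ ∷ []) []))
      ... | yes refl with missed-besides-c
      ... | x , Dx , qx , wx , x≢c = ⊥-elim (fC4 (inducedBy (b ∷ w ∷ β ∷ x ∷ [])
            (wb ˘ ∷ independent Db Dβ qb qβ ∷ sees-rest Db qb wb Dc qc bc Dx qx x≢c
             ∷ wβ ∷ wx ∷ sees-rest Dβ qβ wβ Dc qc βc′ Dx qx x≢c ∷ [])
            (≢-sym β≢b ∷ ≢-sym (≢w Dx) ∷ [])))

      w-isolated : ∀ {i} → D i → q i ≡ false → i ≢ b → A w i ≡ false
      w-isolated Di qi i≢b = ¬-not (i≢b ∘ unique-neighbour Di qi)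

      c-isolated : ∀ {i} → D i → q i ≡ false → i ≢ b → A c i ≡ false
      c-isolated Di qi i≢b = ¬-not λ ci →
        no2K2 (wb , ci , wc , w-isolated Di qi i≢b , bc , independent Db Di qb qi)

      q′ : V → Bool
      q′ = q [ w ≔ false ] [ b ≔ true ] [ c ≔ false ]

      data Status (u : V) (r : Bool) : Set where
        moved-c : u ≡ c → false ≡ r → Status u r
        moved-b : u ≡ b → true ≡ r → Status u r
        added-w : u ≡ w → false ≡ r → Status u r
        kept    : D u → u ≢ c → u ≢ b → q u ≡ r → Status u r

      status : ∀ {u r} → D⁺ u → q′ u ≡ r → Status u r
      status Du e with update-cases e
      ... | inj₁ (u≡c , r) = moved-c u≡c r
      ... | inj₂ (u≢c , e′) with update-cases e′
      ... | inj₁ (u≡b , r) = moved-b u≡b r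
      ... | inj₂ (u≢b , e″) with update-cases e″
      ... | inj₁ (u≡w , r) = added-w u≡w r
      ... | inj₂ (u≢w , qu) = kept (old Du u≢w) u≢c u≢b qu

      b-sees : ∀ {v} → D v → q v ≡ true → v ≢ c → A b v ≡ true
      b-sees Dv qv v≢c = sees-rest Db qb wb Dc qc bc Dv qv v≢c

      split′ : SplitOn D⁺ q′
      split′ .SplitOn.clique Du Dv u≢v eu ev with status Du eu | status Dv ev
      ... | moved-c _ () | _
      ... | added-w _ () | _
      ... | moved-b _ _ | moved-c _ ()
      ... | moved-b _ _ | added-w _ ()
      ... | kept _ _ _ _ | moved-c _ ()
      ... | kept _ _ _ _ | added-w _ ()
      ... | moved-b refl _ | moved-b refl _ = ⊥-elim (u≢v refl)
      ... | moved-b refl _ | kept Dv′ v≢c _ qv = b-sees Dv′ qv v≢c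
      ... | kept Du′ u≢c _ qu | moved-b refl _ = b-sees Du′ qu u≢c ˘
      ... | kept Du′ _ _ qu | kept Dv′ _ _ qv = clique Du′ Dv′ u≢v qu qv

      split′ .SplitOn.independent Du Dv eu ev with status Du eu | status Dv ev
      ... | moved-b _ () | _
      ... | moved-c _ _ | moved-b _ ()
      ... | added-w _ _ | moved-b _ ()
      ... | kept _ _ _ _ | moved-b _ ()
      ... | moved-c refl _ | moved-c refl _ = irrefl G c
      ... | moved-c refl _ | added-w refl _ = wc ˘
      ... | moved-c refl _ | kept Dv′ _ v≢b qv = c-isolated Dv′ qv v≢b
      ... | added-w refl _ | moved-c refl _ = wc
      ... | added-w refl _ | added-w refl _ = irrefl G w
      ... | added-w refl _ | kept Dv′ _ v≢b qv = w-isolated Dv′ qv v≢b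
      ... | kept Du′ _ u≢b qu | moved-c refl _ = c-isolated Du′ qu u≢b ˘
      ... | kept Du′ _ u≢b qu | added-w refl _ = w-isolated Du′ qu u≢b ˘
      ... | kept Du′ _ _ qu | kept Dv′ _ _ qv = independent Du′ Dv′ qu qv

      trade : Σ (V → Bool) (SplitOn D⁺)
      trade = q′ , split′

    extend : Σ (V → Bool) (SplitOn D⁺)
    extend with misses? D? q w
    ... | no ¬missed = joinClique λ Dc qc → ¬-not λ wc → ¬missed (_ , Dc , qc , wc)
    ... | yes (a , Da , qa , wa)
      with any? (λ x → D? x ×-dec (q x ≟ᵇ false) ×-dec (A w x ≟ᵇ true))
    ... | no ¬seen = joinIndependent λ Di qi → ¬-not λ wi → ¬seen (_ , Di , qi , wi)
    ... | yes (b , Db , qb , wb)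
      with any? (λ x → D? x ×-dec (q x ≟ᵇ true) ×-dec (A w x ≟ᵇ false) ×-dec ¬? (x ≟ᶠ a))
    ... | no ¬other = TradeWithOnlyMissed.trade Da qa wa Db qb wb
                        λ Dc qc c≢a → ¬-not λ wc → ¬other (_ , Dc , qc , wc , c≢a)
    ... | yes (a′ , Da′ , qa′ , wa′ , a′≢a) with sat Db qb
    ... | c , Dc , qc , bc = TradeThroughNeighbour.trade Da qa wa Da′ qa′ wa′ a′≢a Db qb wb Dc qc bc

  Below : ℕ → V → Set
  Below k u = toℕ u ℕ.< k

  module _ (no2K2 : ∀ {a b c d} → ¬ Is2K2 a b c d) (fC4 : Free C4 G) (fC5 : Free C5 G) where

    splitBelow : ∀ k → k ℕ.≤ n G →
                 Σ (V → Bool) λ q → SplitOn (Below k) q × Saturated (Below k) q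
    splitBelow zero _ = (λ _ → false) , record { clique = λ () ; independent = λ () } , λ ()
    splitBelow (suc k) k<n with splitBelow k (≤-trans (n≤1+n k) k<n)
    ... | q , sp , sat with Extend.extend no2K2 fC4 fC5 (λ u → toℕ u <? k) sp sat w∉
      where
      w∉ : ¬ Below k (fromℕ< k<n)
      w∉ = <-irrefl (toℕ-fromℕ< k<n)
    ... | q′ , sp′ = saturate (λ u → toℕ u <? suc k) (splitOn-⊆ below-suc sp′)
      where
      below-suc : ∀ {u} → Below (suc k) u → Below k u ⊎ u ≡ fromℕ< k<n
      below-suc u<1+k with m<1+n⇒m<n∨m≡n u<1+k
      ... | inj₁ u<k = inj₁ u<k
      ... | inj₂ u≡k = inj₂ (toℕ-injective (trans u≡k (≡-sym (toℕ-fromℕ< k<n))))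

    2K2-free⇒split : Is2K2Split G
    2K2-free⇒split with splitBelow (n G) ≤-refl
    ... | q , sp , _ = part , record
      { clique = λ u v u≢v eu ev → clique (toℕ<n u) (toℕ<n v) u≢v (inC⇒q eu) (inC⇒q ev)
      ; independent = λ u v eu ev → independent (toℕ<n u) (toℕ<n v) (inI⇒q eu) (inI⇒q ev)
      ; S-shape = inj₁ λ v → ≢inS
      ; C-S-full = λ _ _ _ ev → ⊥-elim (≢inS ev)
      ; I-S-empty = λ _ _ _ ev → ⊥-elim (≢inS ev)
      }
      where
      open SplitOn sp
      part : V → Part
      part v = if q v then inC else inI
      inC⇒q : ∀ {v} → part v ≡ inC → q v ≡ true
      inC⇒q {v} e with q v
      ... | true = refl
      inC⇒q {v} () | false
      inI⇒q : ∀ {v} → part v ≡ inI → q v ≡ false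
      inI⇒q {v} e with q v
      ... | false = refl
      inI⇒q {v} () | true
      ≢inS : ∀ {v} → part v ≢ inS
      ≢inS {v} e with q v
      ≢inS {v} () | true
      ≢inS {v} () | false

forbiddenFree⇒split : ∀ {G} → Free C4 G → Free C5 G → Free K2+P3 G → Free K2+K3 G →
                      Free P5 G → Free coBanner G → Free 3K2 G → Is2K2Split G
forbiddenFree⇒split {G} fC4 fC5 fK2P3 fK2K3 fP5 fCB f3K2
  with any? (λ a → any? (λ b → any? (λ c → any? (λ d → is2K2? {G} a b c d))))
... | yes (_ , _ , _ , _ , ab , cd , ac , ad , bc , bd) =
  AroundInduced2K2.split fC4 fK2P3 fK2K3 fP5 fCB f3K2 ab cd ac ad bc bd
... | no no2K2 = 2K2-free⇒split (λ t → no2K2 (_ , _ , _ , _ , t)) fC4 fC5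

mainTheorem11 : (G : Graph) →
    Is2K2Split G ⇔
      (Free C4 G × Free C5 G × Free K2+P3 G × Free K2+K3 G
        × Free P5 G × Free coBanner G × Free 3K2 G)
mainTheorem11 G = mk⇔ split⇒forbiddenFree
  λ (fC4 , fC5 , fK2P3 , fK2K3 , fP5 , fCB , f3K2) → forbiddenFree⇒split fC4 fC5 fK2P3 fK2K3 fP5 fCB f3K2
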